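{- If $G$ and $H$ are connected nontrivial graphs, then $\chi_o(G\Box H)\le \min\{\chi(G)\cdot\chi_o(H),\ \chi_o(G)\cdot\chi(H)\}\le \chi_o(G)\cdot\chi_o(H)$.
   Context: All graphs are finite, simple and undirected. $\chi$ denotes the ordinary chromatic number and $G\Box H$ the Cartesian product of graphs. A proper vertex coloring $\varphi$ of a graph $G$ is called an odd coloring if for every non-isolated vertex $x$ of $G$ there is a color $c$ such that the number of neighbors $y\in N(x)$ with $\varphi(y)=c$ is odd. The odd chromatic number $\chi_o(G)$ is the minimum number of colors in an odd coloring of $G$. A graph is nontrivial if it has at least two vertices. -}

module Defs where

open import Data.Nat using (ℕ; zero; suc; _+_; _*_; _≤_; _⊓_)
open import Data.Fin using (Fin; _≟_; remQuot)
open import Data.Bool using (Bool; true; false; _∧_; _∨_; if_then_else_)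
open import Data.List using (List; map; allFin)
open import Data.Nat.ListAction using (sum)
open import Data.Product using (Σ; _×_; _,_; proj₁; proj₂; ∃)
open import Relation.Nullary using (¬_)
open import Relation.Nullary.Decidable using (⌊_⌋)
open import Relation.Binary.PropositionalEquality using (_≡_; _≢_)

record Graph : Set where
  field
    n     : ℕ
    adj   : Fin n → Fin n → Bool
    sym   : ∀ x y → adj x y ≡ adj y x
    irrefl : ∀ x → adj x x ≡ false
open Graph public

data Walk (G : Graph) : Fin (n G) → Fin (n G) → Set where
  here : ∀ {u} → Walk G u u
  step : ∀ {u v w} → adj G u v ≡ true → Walk G v w → Walk G u w

Connected : Graph → Set
Connected G = ∀ (u v : Fin (n G)) → Walk G u v

Nontrivial : Graph → Set
Nontrivial G = 2 ≤ n G

-- Cartesian product G □ H on vertex set Fin (n G * n H);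
-- a vertex x corresponds to the pair remQuot x = (g , h).
_□_ : Graph → Graph → Graph
G □ H = record
  { n = n G * n H
  ; adj = λ x y → prodAdj (remQuot (n H) x) (remQuot (n H) y)
  ; sym = λ x y → prodSym (remQuot (n H) x) (remQuot (n H) y)
  ; irrefl = λ x → prodIrr (remQuot (n H) x)
  }
  where
  prodAdj : Fin (n G) × Fin (n H) → Fin (n G) × Fin (n H) → Bool
  prodAdj (g , h) (g' , h') = (⌊ g ≟ g' ⌋ ∧ adj H h h') ∨ (⌊ h ≟ h' ⌋ ∧ adj G g g')
  open import Data.Bool.Properties using (∧-comm; ∨-comm)
  open import Relation.Binary.PropositionalEquality using (cong₂; refl)
  eqb-refl : ∀ {k} (a : Fin k) → ⌊ a ≟ a ⌋ ≡ true
  eqb-refl a with a ≟ a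
  ... | Relation.Nullary.yes _ = refl
  ... | Relation.Nullary.no q = Data.Empty.⊥-elim (q refl)
    where import Data.Empty
  eqb-sym : ∀ {k} (a b : Fin k) → ⌊ a ≟ b ⌋ ≡ ⌊ b ≟ a ⌋
  eqb-sym a b with a ≟ b | b ≟ a
  ... | Relation.Nullary.yes _ | Relation.Nullary.yes _ = refl
  ... | Relation.Nullary.no _ | Relation.Nullary.no _ = refl
  ... | Relation.Nullary.yes refl | Relation.Nullary.no q = Data.Empty.⊥-elim (q refl)
    where import Data.Empty
  ... | Relation.Nullary.no q | Relation.Nullary.yes refl = Data.Empty.⊥-elim (q refl)
    where import Data.Empty
  prodSym : ∀ p q → prodAdj p q ≡ prodAdj q p
  prodSym (g , h) (g' , h') =
    cong₂ _∨_ (cong₂ _∧_ (eqb-sym g g') (sym H h h'))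
              (cong₂ _∧_ (eqb-sym h h') (sym G g g'))
  prodIrr : ∀ p → prodAdj p p ≡ false
  prodIrr (g , h) rewrite eqb-refl g | eqb-refl h | irrefl H h | irrefl G g = refl

Coloring : Graph → ℕ → Set
Coloring G k = Fin (n G) → Fin k

Proper : (G : Graph) {k : ℕ} → Coloring G k → Set
Proper G φ = ∀ x y → adj G x y ≡ true → φ x ≢ φ y

nbrCount : (G : Graph) {k : ℕ} → Coloring G k → Fin (n G) → Fin k → ℕ
nbrCount G φ x c =
  sum (map (λ y → if adj G x y ∧ ⌊ φ y ≟ c ⌋ then 1 else 0) (allFin (n G)))

Odd : ℕ → Set
Odd m = Σ ℕ λ j → m ≡ suc (2 * j)

NonIsolated : (G : Graph) → Fin (n G) → Set
NonIsolated G x = Σ (Fin (n G)) λ y → adj G x y ≡ true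

OddColoring : (G : Graph) {k : ℕ} → Coloring G k → Set
OddColoring G φ =
  Proper G φ × (∀ x → NonIsolated G x → Σ _ λ c → Odd (nbrCount G φ x c))

IsChromaticNumber : Graph → ℕ → Set
IsChromaticNumber G k =
  (Σ (Coloring G k) λ φ → Proper G φ) ×
  (∀ j → (φ : Coloring G j) → Proper G φ → k ≤ j)

IsOddChromaticNumber : Graph → ℕ → Set
IsOddChromaticNumber G k =
  (Σ (Coloring G k) λ φ → OddColoring G φ) ×
  (∀ j → (φ : Coloring G j) → OddColoring G φ → k ≤ j)

{-# OPTIONS --safe #-}
module Submission where

-- Colour the vertex (g , h) of G □ H by the pair (α g , β h) of a proper colouring α of G
-- and an odd colouring β of H; this is proper. A G-neighbour (g′ , h) of (g , h) has
-- α g′ ≠ α g, so the neighbours of (g , h) coloured (α g , c) are exactly the (g , h′) with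
-- h′ ~ h and β h′ = c, and for the colour c that is odd at h there is an odd number of them.
-- Exchanging the roles of G and H bounds χₒ(G □ H) by χₒ(G) · χ(H); the last inequality
-- holds because an odd colouring is proper, so χ(G) ≤ χₒ(G).

open import Defs hiding (sym)
open import Data.Nat using (ℕ; zero; suc; _+_; _*_; _≤_; _⊓_; s≤s)
open import Data.Nat.Properties
  using (+-assoc; +-identityʳ; ⊓-glb; m⊓n≤m; *-monoˡ-≤; ≤-trans; +-0-commutativeMonoid)
import Data.Nat.ListAction as List
open import Algebra.Properties.CommutativeMonoid.Sum +-0-commutativeMonoid
  using (sum; sum-syntax; sum-cong-≗; sum-replicate-zero; sum-remove; ∑-comm)
open import Data.Fin using (Fin; zero; suc; _≟_; remQuot; combine; _↑ˡ_; _↑ʳ_; punchIn)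
open import Data.Fin.Properties
  using (remQuot-combine; combine-injectiveˡ; combine-injectiveʳ; punchInᵢ≢i)
open import Data.Bool using (Bool; true; false; _∧_; _∨_; if_then_else_)
open import Data.Bool.Properties using (∧-assoc; ∧-comm; ∧-zeroʳ; ∨-identityʳ)
open import Data.List using (tabulate)
open import Data.List.Properties using (map-tabulate)
open import Data.Product using (_×_; _,_; proj₁; proj₂)
open import Data.Sum using (_⊎_; inj₁; inj₂; [_,_])
open import Function using (_∘_; id)
open import Relation.Nullary using (yes; no; contradiction)
open import Relation.Nullary.Decidable using (⌊_⌋; isYes≗does; dec-true; dec-false)
open import Relation.Binary.PropositionalEquality
  using (_≡_; _≢_; refl; sym; trans; cong; subst; module ≡-Reasoning)

𝟙 : Bool → ℕ
𝟙 b = if b then 1 else 0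

⌊≟⌋-refl : ∀ {k} (i : Fin k) → ⌊ i ≟ i ⌋ ≡ true
⌊≟⌋-refl i = trans (isYes≗does (i ≟ i)) (dec-true (i ≟ i) refl)

⌊≟⌋-false : ∀ {k} {i j : Fin k} → i ≢ j → ⌊ i ≟ j ⌋ ≡ false
⌊≟⌋-false {i = i} {j} i≢j = trans (isYes≗does (i ≟ j)) (dec-false (i ≟ j) i≢j)

⌊combine≟combine⌋ : ∀ {m k} (i i′ : Fin m) (j j′ : Fin k) →
  ⌊ combine i j ≟ combine i′ j′ ⌋ ≡ ⌊ i ≟ i′ ⌋ ∧ ⌊ j ≟ j′ ⌋
⌊combine≟combine⌋ i i′ j j′ with i ≟ i′ | j ≟ j′
... | yes refl | yes refl = ⌊≟⌋-refl (combine i j)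
... | no i≢i′  | _        = ⌊≟⌋-false (i≢i′ ∘ combine-injectiveˡ i j i′ j′)
... | yes refl | no j≢j′  = ⌊≟⌋-false (j≢j′ ∘ combine-injectiveʳ i j i j′)

sum-tabulate : ∀ {n} (f : Fin n → ℕ) → List.sum (tabulate f) ≡ ∑[ i < n ] f i
sum-tabulate {zero}  f = refl
sum-tabulate {suc n} f = cong (f zero +_) (sum-tabulate (f ∘ suc))

∑-↑ : ∀ m {n} (f : Fin (m + n) → ℕ) →
  ∑[ x < m + n ] f x ≡ ∑[ i < m ] f (i ↑ˡ n) + ∑[ j < n ] f (m ↑ʳ j)
∑-↑ zero    f = refl
∑-↑ (suc m) f = trans (cong (f zero +_) (∑-↑ m (f ∘ suc))) (sym (+-assoc (f zero) _ _))

∑-combine : ∀ m n (f : Fin (m * n) → ℕ) →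
  ∑[ x < m * n ] f x ≡ ∑[ i < m ] ∑[ j < n ] f (combine i j)
∑-combine zero    n f = refl
∑-combine (suc m) n f =
  trans (∑-↑ n f) (cong (∑[ j < n ] f (j ↑ˡ m * n) +_) (∑-combine m n (f ∘ (n ↑ʳ_))))

∑-zero : ∀ {n} (f : Fin n → ℕ) → (∀ i → f i ≡ 0) → ∑[ i < n ] f i ≡ 0
∑-zero {n} f f≗0 = trans (sum-cong-≗ f≗0) (sum-replicate-zero n)

∑-single : ∀ {n} (f : Fin n → ℕ) i → (∀ j → j ≢ i → f j ≡ 0) → ∑[ j < n ] f j ≡ f i
∑-single {suc n} f i f≗0 = begin
  sum f                             ≡⟨ sum-remove {i = i} f ⟩
  f i + ∑[ j < n ] f (punchIn i j)  ≡⟨ cong (f i +_) (∑-zero _ (λ j → f≗0 _ (punchInᵢ≢i i j))) ⟩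
  f i + 0                           ≡⟨ +-identityʳ (f i) ⟩
  f i                               ∎
  where open ≡-Reasoning

∑-indicator : ∀ {n} (i : Fin n) (b : Fin n → Bool) → ∑[ j < n ] 𝟙 (⌊ i ≟ j ⌋ ∧ b j) ≡ 𝟙 (b i)
∑-indicator i b = trans (∑-single _ i off-i) (cong (λ d → 𝟙 (d ∧ b i)) (⌊≟⌋-refl i))
  where
  off-i : ∀ j → j ≢ i → 𝟙 (⌊ i ≟ j ⌋ ∧ b j) ≡ 0
  off-i j j≢i = cong (λ d → 𝟙 (d ∧ b j)) (⌊≟⌋-false (j≢i ∘ sym))

nbrCount-∑ : ∀ (G : Graph) {k} (φ : Coloring G k) x c →
  nbrCount G φ x c ≡ ∑[ y < n G ] 𝟙 (adj G x y ∧ ⌊ φ y ≟ c ⌋)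
nbrCount-∑ G φ x c = trans (cong List.sum (map-tabulate id count)) (sum-tabulate count)
  where
  count : Fin (n G) → ℕ
  count y = 𝟙 (adj G x y ∧ ⌊ φ y ≟ c ⌋)

walk⇒nonIsolated : ∀ (G : Graph) {u w} → u ≢ w → Walk G u w → NonIsolated G u
walk⇒nonIsolated G u≢u here = contradiction refl u≢u
walk⇒nonIsolated G _ (step {v = v} u~v _) = v , u~v

connected⇒nonIsolated : ∀ (G : Graph) → Connected G → Nontrivial G → ∀ x → NonIsolated G x
connected⇒nonIsolated G connected (s≤s (s≤s _)) x =
  walk⇒nonIsolated G (punchInᵢ≢i x zero ∘ sym) (connected x (punchIn x zero))

proper⇒adj∧sameColour≡false : ∀ (G : Graph) {k} {φ : Coloring G k} → Proper G φ →
  ∀ x y → adj G x y ∧ ⌊ φ y ≟ φ x ⌋ ≡ false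
proper⇒adj∧sameColour≡false G proper x y with adj G x y in x~y
... | false = refl
... | true  = ⌊≟⌋-false (proper x y x~y ∘ sym)

∧-∨-∧⇒ʳ : ∀ p q r s → (p ∧ q) ∨ (r ∧ s) ≡ true → q ≡ true ⊎ s ≡ true
∧-∨-∧⇒ʳ p true  r s     _ = inj₁ refl
∧-∨-∧⇒ʳ p false r true  _ = inj₂ refl
∧-∨-∧⇒ʳ p false r false e rewrite ∧-zeroʳ p | ∧-zeroʳ r = contradiction e λ ()

∨-∧-dropʳ : ∀ d a e b E F → b ∧ E ≡ false →
  ((d ∧ a) ∨ (e ∧ b)) ∧ (E ∧ F) ≡ d ∧ (a ∧ (E ∧ F))
∨-∧-dropʳ d a false b     E     F _ rewrite ∨-identityʳ (d ∧ a) = ∧-assoc d a (E ∧ F)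
∨-∧-dropʳ d a true  false E     F _ rewrite ∨-identityʳ (d ∧ a) = ∧-assoc d a (E ∧ F)
∨-∧-dropʳ d a true  true  false F _ rewrite ∧-zeroʳ ((d ∧ a) ∨ true) | ∧-zeroʳ a | ∧-zeroʳ d = refl

∨-∧-dropˡ : ∀ d a e b E F → a ∧ F ≡ false →
  ((d ∧ a) ∨ (e ∧ b)) ∧ (E ∧ F) ≡ e ∧ (b ∧ (F ∧ E))
∨-∧-dropˡ false a     e b E F     _ rewrite ∧-comm E F = ∧-assoc e b (F ∧ E)
∨-∧-dropˡ true  false e b E F     _ rewrite ∧-comm E F = ∧-assoc e b (F ∧ E)
∨-∧-dropˡ true  true  e b E false _ rewrite ∧-zeroʳ E | ∧-zeroʳ b | ∧-zeroʳ e = refl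

module ProductColouring (G H : Graph) where

  πᴳ : Fin (n G * n H) → Fin (n G)
  πᴳ x = proj₁ (remQuot {n G} (n H) x)

  πᴴ : Fin (n G * n H) → Fin (n H)
  πᴴ x = proj₂ (remQuot {n G} (n H) x)

  _⊗_ : ∀ {a b} → Coloring G a → Coloring H b → Coloring (G □ H) (a * b)
  (α ⊗ β) x = combine (α (πᴳ x)) (β (πᴴ x))

  ⊗-proper : ∀ {a b} {α : Coloring G a} {β : Coloring H b} →
    Proper G α → Proper H β → Proper (G □ H) (α ⊗ β)
  ⊗-proper {α = α} {β} α-proper β-proper x y x~y αβx≡αβy =
    [ (λ h~h′ → β-proper (πᴴ x) (πᴴ y) h~h′ (combine-injectiveʳ (α (πᴳ x)) _ (α (πᴳ y)) _ αβx≡αβy))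
    , (λ g~g′ → α-proper (πᴳ x) (πᴳ y) g~g′ (combine-injectiveˡ _ (β (πᴴ x)) _ (β (πᴴ y)) αβx≡αβy))
    ] (∧-∨-∧⇒ʳ ⌊ πᴳ x ≟ πᴳ y ⌋ _ ⌊ πᴴ x ≟ πᴴ y ⌋ _ x~y)

  adj-□-combine : ∀ x i j → adj (G □ H) x (combine i j) ≡
    (⌊ πᴳ x ≟ i ⌋ ∧ adj H (πᴴ x) j) ∨ (⌊ πᴴ x ≟ j ⌋ ∧ adj G (πᴳ x) i)
  adj-□-combine x i j = cong adjacent-to-x (remQuot-combine {n G} {n H} i j)
    where
    adjacent-to-x : Fin (n G) × Fin (n H) → Bool
    adjacent-to-x (g , h) = (⌊ πᴳ x ≟ g ⌋ ∧ adj H (πᴴ x) h) ∨ (⌊ πᴴ x ≟ h ⌋ ∧ adj G (πᴳ x) g)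

  ⊗-combine : ∀ {a b} (α : Coloring G a) (β : Coloring H b) i j →
    (α ⊗ β) (combine i j) ≡ combine (α i) (β j)
  ⊗-combine α β i j = cong (λ (g , h) → combine (α g) (β h)) (remQuot-combine {n G} {n H} i j)

  module _ {a b} (α : Coloring G a) (β : Coloring H b) where

    summand-combine : ∀ x k l i j →
      𝟙 (adj (G □ H) x (combine i j) ∧ ⌊ (α ⊗ β) (combine i j) ≟ combine k l ⌋) ≡
      𝟙 (((⌊ πᴳ x ≟ i ⌋ ∧ adj H (πᴴ x) j) ∨ (⌊ πᴴ x ≟ j ⌋ ∧ adj G (πᴳ x) i)) ∧
         (⌊ α i ≟ k ⌋ ∧ ⌊ β j ≟ l ⌋))
    summand-combine x k l i j
      rewrite adj-□-combine x i j | ⊗-combine α β i j | ⌊combine≟combine⌋ (α i) k (β j) l = refl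

    nbrCount-⊗-sameᴳ : Proper G α → ∀ x c →
      nbrCount (G □ H) (α ⊗ β) x (combine (α (πᴳ x)) c) ≡ nbrCount H β (πᴴ x) c
    nbrCount-⊗-sameᴳ α-proper x c = begin
      nbrCount (G □ H) (α ⊗ β) x (combine (α g) c)
        ≡⟨ nbrCount-∑ (G □ H) (α ⊗ β) x _ ⟩
      ∑[ y < n G * n H ] 𝟙 (adj (G □ H) x y ∧ ⌊ (α ⊗ β) y ≟ combine (α g) c ⌋)
        ≡⟨ ∑-combine (n G) (n H) _ ⟩
      ∑[ i < n G ] ∑[ j < n H ] 𝟙 (adj (G □ H) x (combine i j) ∧ ⌊ (α ⊗ β) (combine i j) ≟ combine (α g) c ⌋)
        ≡⟨ sum-cong-≗ (λ i → sum-cong-≗ (summand-row i)) ⟩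
      ∑[ i < n G ] ∑[ j < n H ] 𝟙 (⌊ g ≟ i ⌋ ∧ matches i j)
        ≡⟨ ∑-comm (λ i j → 𝟙 (⌊ g ≟ i ⌋ ∧ matches i j)) ⟩
      ∑[ j < n H ] ∑[ i < n G ] 𝟙 (⌊ g ≟ i ⌋ ∧ matches i j)
        ≡⟨ sum-cong-≗ (λ j → ∑-indicator g (λ i → matches i j)) ⟩
      ∑[ j < n H ] 𝟙 (matches g j)
        ≡⟨ sum-cong-≗ (λ j → cong (λ t → 𝟙 (adj H h j ∧ (t ∧ ⌊ β j ≟ c ⌋))) (⌊≟⌋-refl (α g))) ⟩
      ∑[ j < n H ] 𝟙 (adj H h j ∧ ⌊ β j ≟ c ⌋)
        ≡⟨ sym (nbrCount-∑ H β h c) ⟩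
      nbrCount H β h c ∎
      where
      open ≡-Reasoning
      g : Fin (n G)
      g = πᴳ x
      h : Fin (n H)
      h = πᴴ x
      matches : Fin (n G) → Fin (n H) → Bool
      matches i j = adj H h j ∧ (⌊ α i ≟ α g ⌋ ∧ ⌊ β j ≟ c ⌋)
      summand-row : ∀ i j →
        𝟙 (adj (G □ H) x (combine i j) ∧ ⌊ (α ⊗ β) (combine i j) ≟ combine (α g) c ⌋) ≡
        𝟙 (⌊ g ≟ i ⌋ ∧ matches i j)
      summand-row i j = trans (summand-combine x (α g) c i j) (cong 𝟙
        (∨-∧-dropʳ ⌊ g ≟ i ⌋ (adj H h j) ⌊ h ≟ j ⌋ (adj G g i) ⌊ α i ≟ α g ⌋ ⌊ β j ≟ c ⌋
                   (proper⇒adj∧sameColour≡false G α-proper g i)))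

    nbrCount-⊗-sameᴴ : Proper H β → ∀ x k →
      nbrCount (G □ H) (α ⊗ β) x (combine k (β (πᴴ x))) ≡ nbrCount G α (πᴳ x) k
    nbrCount-⊗-sameᴴ β-proper x k = begin
      nbrCount (G □ H) (α ⊗ β) x (combine k (β h))
        ≡⟨ nbrCount-∑ (G □ H) (α ⊗ β) x _ ⟩
      ∑[ y < n G * n H ] 𝟙 (adj (G □ H) x y ∧ ⌊ (α ⊗ β) y ≟ combine k (β h) ⌋)
        ≡⟨ ∑-combine (n G) (n H) _ ⟩
      ∑[ i < n G ] ∑[ j < n H ] 𝟙 (adj (G □ H) x (combine i j) ∧ ⌊ (α ⊗ β) (combine i j) ≟ combine k (β h) ⌋)
        ≡⟨ sum-cong-≗ (λ i → sum-cong-≗ (summand-column i)) ⟩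
      ∑[ i < n G ] ∑[ j < n H ] 𝟙 (⌊ h ≟ j ⌋ ∧ matches i j)
        ≡⟨ sum-cong-≗ (λ i → ∑-indicator h (matches i)) ⟩
      ∑[ i < n G ] 𝟙 (matches i h)
        ≡⟨ sum-cong-≗ (λ i → cong (λ t → 𝟙 (adj G g i ∧ (t ∧ ⌊ α i ≟ k ⌋))) (⌊≟⌋-refl (β h))) ⟩
      ∑[ i < n G ] 𝟙 (adj G g i ∧ ⌊ α i ≟ k ⌋)
        ≡⟨ sym (nbrCount-∑ G α g k) ⟩
      nbrCount G α g k ∎
      where
      open ≡-Reasoning
      g : Fin (n G)
      g = πᴳ x
      h : Fin (n H)
      h = πᴴ x
      matches : Fin (n G) → Fin (n H) → Bool
      matches i j = adj G g i ∧ (⌊ β j ≟ β h ⌋ ∧ ⌊ α i ≟ k ⌋)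
      summand-column : ∀ i j →
        𝟙 (adj (G □ H) x (combine i j) ∧ ⌊ (α ⊗ β) (combine i j) ≟ combine k (β h) ⌋) ≡
        𝟙 (⌊ h ≟ j ⌋ ∧ matches i j)
      summand-column i j = trans (summand-combine x k (β h) i j) (cong 𝟙
        (∨-∧-dropˡ ⌊ g ≟ i ⌋ (adj H h j) ⌊ h ≟ j ⌋ (adj G g i) ⌊ α i ≟ k ⌋ ⌊ β j ≟ β h ⌋
                   (proper⇒adj∧sameColour≡false H β-proper h j)))

  ⊗-oddᴴ : ∀ {a b} {α : Coloring G a} {β : Coloring H b} → Proper G α → OddColoring H β →
    (∀ h → NonIsolated H h) → OddColoring (G □ H) (α ⊗ β)
  ⊗-oddᴴ {α = α} {β} α-proper (β-proper , β-odd) H-nonIsolated =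
    ⊗-proper α-proper β-proper , λ x _ →
      let (c , odd) = β-odd (πᴴ x) (H-nonIsolated (πᴴ x))
      in combine (α (πᴳ x)) c , subst Odd (sym (nbrCount-⊗-sameᴳ α β α-proper x c)) odd

  ⊗-oddᴳ : ∀ {a b} {α : Coloring G a} {β : Coloring H b} → OddColoring G α → Proper H β →
    (∀ g → NonIsolated G g) → OddColoring (G □ H) (α ⊗ β)
  ⊗-oddᴳ {α = α} {β} (α-proper , α-odd) β-proper G-nonIsolated =
    ⊗-proper α-proper β-proper , λ x _ →
      let (k , odd) = α-odd (πᴳ x) (G-nonIsolated (πᴳ x))
      in combine k (β (πᴴ x)) , subst Odd (sym (nbrCount-⊗-sameᴴ α β β-proper x k)) odd

mainTheorem7 : (G H : Graph) → Connected G → Connected H → Nontrivial G → Nontrivial H →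
    (a b c d e : ℕ) →
    IsChromaticNumber G a → IsOddChromaticNumber G b →
    IsChromaticNumber H c → IsOddChromaticNumber H d →
    IsOddChromaticNumber (G □ H) e →
    (e ≤ (a * d) ⊓ (b * c)) × ((a * d) ⊓ (b * c) ≤ b * d)
mainTheorem7 G H G-connected H-connected G-nontrivial H-nontrivial a b c d e
  ((α , α-proper) , χ-minimal) ((ψ , ψ-odd) , _) ((β , β-proper) , _) ((ϑ , ϑ-odd) , _)
  (_ , χₒ-minimal) =
    ⊓-glb (χₒ-minimal (a * d) (α ⊗ ϑ) (⊗-oddᴴ α-proper ϑ-odd H-nonIsolated))
          (χₒ-minimal (b * c) (ψ ⊗ β) (⊗-oddᴳ ψ-odd β-proper G-nonIsolated))
  , ≤-trans (m⊓n≤m (a * d) (b * c)) (*-monoˡ-≤ d (χ-minimal b ψ (proj₁ ψ-odd)))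
  where
  open ProductColouring G H
  G-nonIsolated : ∀ g → NonIsolated G g
  G-nonIsolated = connected⇒nonIsolated G G-connected G-nontrivial
  H-nonIsolated : ∀ h → NonIsolated H h
  H-nonIsolated = connected⇒nonIsolated H H-connected H-nontrivial
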